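{- Let $G$ be a $2$-edge-colored multigraph that is $2$-$\mathcal{M}$-closed, and let $C_1=(x_1,\ldots,x_n,x_1)$ and $C_2=(y_1,\ldots,y_m,y_1)$ be two vertex-disjoint alternating cycles in $G$ (subscripts of $x$ taken modulo $n$, of $y$ modulo $m$). Suppose there is an edge $[x_i,y_j]$ of $G$ with $c[x_i,x_{i+1}]=c[y_j,y_{j+1}]=c[x_i,y_j]$. Then either $[x_{i+1},y_{j+1}]$, $[x_i,y_{j+1}]$ and $[y_j,x_{i+1}]$ are edges of $G$ with $c[x_{i+1},y_{j+1}]\neq c[x_i,y_j]$, or there exists an alternating cycle in $G$ with vertex set $V(C_1)\cup V(C_2)$.
   Context: $G$ is a loopless multigraph whose edges are colored blue or red; $c[u,v]$ denotes the color of edge $[u,v]$. A cycle is alternating if no two consecutive edges have the same color. $G$ is $2$-$\mathcal{M}$-closed if for every monochromatic $2$-path $(x_1,x_2,x_3)$ (both edges the same color) there exists an edge between $x_1$ and $x_3$. -}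

module Defs where

open import Data.Nat using (ℕ; zero; suc; _≤_)
open import Data.Nat.DivMod using (_mod_)
open import Data.Fin using (Fin; toℕ)
open import Data.Product using (Σ; ∃; _×_; _,_)
open import Data.Sum using (_⊎_)
open import Data.Empty using (⊥)
open import Relation.Nullary using (¬_)
open import Relation.Binary.PropositionalEquality using (_≡_; _≢_)
open import Function.Definitions using (Injective)

data Colour : Set where
  blue red : Colour

-- A 2-edge-coloured loopless multigraph, recorded by which coloured
-- edges join which pairs of vertices: Edge u v c  means "there is an
-- edge [u,v] of colour c".  (Parallel edges of the same colour are
-- irrelevant to every notion below.)
record ColouredMultigraph : Set₁ where
  field
    Vertex   : Set
    Edge     : Vertex → Vertex → Colour → Set
    sym      : ∀ {u v c} → Edge u v c → Edge v u c
    loopless : ∀ {u c} → ¬ Edge u u c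

next : ∀ {k} → Fin (suc k) → Fin (suc k)
next {k} i = suc (toℕ i) mod (suc k)

module _ (G : ColouredMultigraph) where
  open ColouredMultigraph G

  TwoMClosed : Set
  TwoMClosed = ∀ {x₁ x₂ x₃ c} → x₁ ≢ x₃ →
    Edge x₁ x₂ c → Edge x₂ x₃ c → ∃ λ c′ → Edge x₁ x₃ c′

  record AltCycle : Set where
    field
      k      : ℕ
      k≥1    : 1 ≤ k
      vert   : Fin (suc k) → Vertex
      inj    : Injective _≡_ _≡_ vert
      col    : Fin (suc k) → Colour
      edge   : ∀ i → Edge (vert i) (vert (next i)) (col i)
      alt    : ∀ i → col i ≢ col (next i)

  _∈V_ : Vertex → AltCycle → Set
  v ∈V C = ∃ λ i → AltCycle.vert C i ≡ v

  VertexDisjoint : AltCycle → AltCycle → Set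
  VertexDisjoint C D = ∀ v → v ∈V C → v ∈V D → ⊥

-- The edges
-- [x_i,y_{j+1}] and [y_j,x_{i+1}] come straight from 2-M-closedness; the
-- whole difficulty is the edge [x_{i+1},y_{j+1}].
--
-- For a colour d let h_d p (resp. v_d q) be the other end of the d-coloured
-- cycle edge at x_p (resp. y_q).  These involutions cut the torus
-- Fin n₁ × Fin n₂ of cross pairs into 2×2 "d-blocks".  If some d-block
-- carries two diagonal cross d-edges, the two cycles splice into one
-- alternating cycle on V(C₁) ∪ V(C₂).  Otherwise we saturate the known cross
-- edges under 2-M-closedness (a d-edge at (p,q) forces some edge at
-- (h_d p, q) and at (p, v_d q)), and a double count over all blocks shows
-- that every d-edge has a d-edge as row- or column-mate in its d-block.
-- Closure then puts an edge at the opposite corner (i+1, j+1) of the block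
-- of (i,j), and its colour is not d, as that would be a diagonal d-pair.
module Submission where

open import Defs
open import Data.Bool using (Bool; true; false; _∨_; _∧_; not)
open import Data.Bool.Properties using (∨-zeroʳ; ∨-identityʳ)
open import Data.Empty using (⊥; ⊥-elim)
open import Data.Fin using (Fin; zero; suc; toℕ; fromℕ; inject₁; opposite; splitAt; join; _↑ˡ_; _↑ʳ_)
open import Data.Fin.Permutation using (permutation)
open import Data.Fin.Properties using (_≟_; toℕ-injective; toℕ-fromℕ<; toℕ-fromℕ; toℕ-inject₁; toℕ<n; toℕ≤pred[n]; opposite-prop; opposite-involutive; splitAt-↑ˡ; splitAt-↑ʳ; splitAt-join; join-splitAt; toℕ-↑ˡ; toℕ-↑ʳ)
open import Data.List using (_∷_; [])
open import Data.Nat using (ℕ; zero; suc; _+_; _*_; _∸_; _≤_; _<_; z≤n; s≤s; pred)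
open import Data.Nat.DivMod using (_%_; n%n≡0; m<n⇒m%n≡m)
open import Data.Nat.Induction using (<-wellFounded)
import Data.Nat.Properties as ℕ
open import Data.Nat.Tactic.RingSolver using (solve; solve-∀)
open import Data.Product using (∃; _×_; _,_; proj₁; proj₂)
open import Data.Sum using (_⊎_; inj₁; inj₂; [_,_]; map₁)
open import Data.Sum.Function.Propositional using (_⊎-⇔_)
open import Function using (_∘_; _on_; id)
open import Function.Bundles using (_⇔_; mk⇔; Equivalence)
import Function.Properties.Equivalence as ⇔
open import Induction.WellFounded using (Acc; acc)
import Relation.Binary.Construct.On as On
open import Relation.Binary.PropositionalEquality using (_≡_; _≢_; refl; sym; trans; cong; cong₂; subst; subst₂; module ≡-Reasoning)
open import Relation.Nullary using (Dec; yes; no; does)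
open import Relation.Nullary.Decidable using (dec-true)
open import Algebra.Properties.CommutativeMonoid.Sum ℕ.+-0-commutativeMonoid using (sum; ∑-distrib-+; ∑-permute; sum-cong-≗)

-- Cyclic index arithmetic on Fin (suc k)

last : ∀ {k} → Fin (suc k)
last {k} = fromℕ k

prev : ∀ {k} → Fin (suc k) → Fin (suc k)
prev zero = last
prev (suc j) = inject₁ j

below-or-last : ∀ {k} (i : Fin (suc k)) → toℕ i < k ⊎ toℕ i ≡ k
below-or-last i = ℕ.m≤n⇒m<n∨m≡n (toℕ≤pred[n] i)

is-last : ∀ {k} (a : Fin (suc k)) → toℕ a ≡ k → a ≡ last
is-last {k} a eq = toℕ-injective (trans eq (sym (toℕ-fromℕ k)))

next-below : ∀ {k} (i : Fin (suc k)) → toℕ i < k → toℕ (next i) ≡ suc (toℕ i)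
next-below i lt = trans (toℕ-fromℕ< _) (m<n⇒m%n≡m (s≤s lt))

next-at-last : ∀ {k} (i : Fin (suc k)) → toℕ i ≡ k → next i ≡ zero
next-at-last {k} i eq =
  toℕ-injective (trans (toℕ-fromℕ< _) (trans (cong (λ x → suc x % suc k) eq) (n%n≡0 (suc k))))

next-last : ∀ {k} → next (last {k}) ≡ zero
next-last {k} = next-at-last last (toℕ-fromℕ k)

next-prev : ∀ {k} (i : Fin (suc k)) → next (prev i) ≡ i
next-prev zero = next-last
next-prev {k} (suc j) = toℕ-injective (trans (next-below (inject₁ j) below) (cong suc (toℕ-inject₁ j)))
  where
  below : toℕ (inject₁ j) < k
  below = subst (_< k) (sym (toℕ-inject₁ j)) (toℕ<n j)

prev-next : ∀ {k} (i : Fin (suc k)) → prev (next i) ≡ i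
prev-next {k} i with below-or-last i
... | inj₂ eq rewrite next-at-last i eq = toℕ-injective (trans (toℕ-fromℕ k) (sym eq))
... | inj₁ lt with next i | next-below i lt
...   | suc j | eq = toℕ-injective (trans (toℕ-inject₁ j) (ℕ.suc-injective eq))

next-injective : ∀ {k} {i j : Fin (suc k)} → next i ≡ next j → i ≡ j
next-injective {i = i} {j} eq = trans (sym (prev-next i)) (trans (cong prev eq) (prev-next j))

opposite-next : ∀ {k} (i : Fin (suc k)) → opposite (next i) ≡ prev (opposite i)
opposite-next {k} i with below-or-last i
... | inj₂ eq rewrite next-at-last i eq = sym (cong prev opposite-zero)
  where
  opposite-zero : opposite i ≡ zero
  opposite-zero = toℕ-injective (trans (opposite-prop i) (trans (cong (k ∸_) eq) (ℕ.n∸n≡0 k)))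
... | inj₁ lt with opposite i | opposite-prop i
...   | zero | e = ⊥-elim (ℕ.<-irrefl e (ℕ.m<n⇒0<n∸m lt))
...   | suc j | e = toℕ-injective (trans (opposite-prop (next i)) (trans (cong (k ∸_) (next-below i lt))
                      (trans (sym (ℕ.pred[m∸n]≡m∸[1+n] k (toℕ i))) (trans (cong pred (sym e)) (sym (toℕ-inject₁ j))))))

rotate : ∀ {k} → ℕ → Fin (suc k) → Fin (suc k)
rotate zero i = i
rotate (suc r) i = next (rotate r i)

unrotate : ∀ {k} → ℕ → Fin (suc k) → Fin (suc k)
unrotate zero i = i
unrotate (suc r) i = unrotate r (prev i)

rotate-next : ∀ {k} r (i : Fin (suc k)) → rotate r (next i) ≡ next (rotate r i)
rotate-next zero i = refl
rotate-next (suc r) i = cong next (rotate-next r i)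

rotate-unrotate : ∀ {k} r (j : Fin (suc k)) → rotate r (unrotate r j) ≡ j
rotate-unrotate zero j = refl
rotate-unrotate (suc r) j = trans (cong next (rotate-unrotate r (prev j))) (next-prev j)

rotate-injective : ∀ {k} r {i j : Fin (suc k)} → rotate r i ≡ rotate r j → i ≡ j
rotate-injective zero eq = eq
rotate-injective (suc r) eq = rotate-injective r (next-injective eq)

rotate-zero : ∀ {k} t → t ≤ k → toℕ (rotate {k} t zero) ≡ t
rotate-zero zero _ = refl
rotate-zero {k} (suc t) le = trans (next-below (rotate t zero) below) (cong suc ih)
  where
  ih : toℕ (rotate {k} t zero) ≡ t
  ih = rotate-zero t (ℕ.≤-trans (ℕ.n≤1+n t) le)
  below : toℕ (rotate {k} t zero) < k
  below = subst (_< k) (sym ih) le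

rotate-last : ∀ {k} (a : Fin (suc k)) → rotate (suc (toℕ a)) (last {k}) ≡ a
rotate-last {k} a = toℕ-injective (trans (cong toℕ eq) (rotate-zero (toℕ a) (toℕ≤pred[n] a)))
  where
  eq : rotate (suc (toℕ a)) (last {k}) ≡ rotate (toℕ a) zero
  eq = trans (sym (rotate-next (toℕ a) last)) (cong (rotate (toℕ a)) next-last)

rotate-first : ∀ {k} (a : Fin (suc k)) → rotate (suc (toℕ a)) zero ≡ next a
rotate-first a = trans (cong (rotate (suc (toℕ a))) (sym next-last))
                       (trans (rotate-next (suc (toℕ a)) last) (cong next (rotate-last a)))

-- Surgery on alternating cycles

module Surgery (G : ColouredMultigraph) where
  open ColouredMultigraph G renaming (sym to edge-sym)
  open AltCycle

  _≈V_ : AltCycle G → AltCycle G → Set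
  C ≈V D = ∀ v → _∈V_ G v C ⇔ _∈V_ G v D

  Union : AltCycle G → AltCycle G → Set
  Union C D = ∃ λ (W : AltCycle G) → ∀ v → _∈V_ G v W ⇔ (_∈V_ G v C ⊎ _∈V_ G v D)

  disjoint-≈V : ∀ {C C′ D D′} → C′ ≈V C → D′ ≈V D → VertexDisjoint G C D → VertexDisjoint G C′ D′
  disjoint-≈V C′≈C D′≈D disj v v∈C′ v∈D′ = disj v (Equivalence.to (C′≈C v) v∈C′) (Equivalence.to (D′≈D v) v∈D′)

  union-≈V : ∀ {C C′ D D′} → C′ ≈V C → D′ ≈V D → Union C′ D′ → Union C D
  union-≈V C′≈C D′≈D (W , W≈) = W , λ v → ⇔.trans (W≈ v) (C′≈C v ⊎-⇔ D′≈D v)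

  rotateC : ℕ → AltCycle G → AltCycle G
  rotateC r C = record
    { k = k C ; k≥1 = k≥1 C
    ; vert = vert C ∘ rotate r
    ; inj = λ eq → rotate-injective r (inj C eq)
    ; col = col C ∘ rotate r
    ; edge = λ i → subst (λ z → Edge (vert C (rotate r i)) (vert C z) (col C (rotate r i)))
                         (sym (rotate-next r i)) (edge C (rotate r i))
    ; alt = λ i eq → alt C (rotate r i) (trans eq (cong (col C) (rotate-next r i))) }

  rotateC-≈V : ∀ r C → rotateC r C ≈V C
  rotateC-≈V r C v = mk⇔ (λ { (i , e) → rotate r i , e })
                         (λ { (i , e) → unrotate r i , trans (cong (vert C) (rotate-unrotate r i)) e })

  -- The same cycle traversed backwards: position i is  opposite i,
  -- and the edge leaving it is the one entering  opposite i  in C.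
  reverseC : AltCycle G → AltCycle G
  reverseC C = record
    { k = k C ; k≥1 = k≥1 C
    ; vert = vert C ∘ opposite
    ; inj = λ eq → opposite-injective (inj C eq)
    ; col = λ i → col C (prev (opposite i))
    ; edge = λ i → subst (λ z → Edge (vert C (opposite i)) (vert C z) (col C (prev (opposite i))))
                         (sym (opposite-next i)) (edge-sym (entering (opposite i)))
    ; alt = λ i eq → alt C (prev (prev (opposite i)))
              (trans (sym (trans eq (cong (col C ∘ prev) (opposite-next i))))
                     (cong (col C) (sym (next-prev (prev (opposite i)))))) }
    where
    opposite-injective : ∀ {n} {x y : Fin n} → opposite x ≡ opposite y → x ≡ y
    opposite-injective {x = x} {y} eq =
      trans (sym (opposite-involutive x)) (trans (cong opposite eq) (opposite-involutive y))
    entering : ∀ a → Edge (vert C (prev a)) (vert C a) (col C (prev a))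
    entering a = subst (λ z → Edge (vert C (prev a)) (vert C z) (col C (prev a))) (next-prev a) (edge C (prev a))

  reverseC-≈V : ∀ C → reverseC C ≈V C
  reverseC-≈V C v = mk⇔ (λ { (i , e) → opposite i , e })
                        (λ { (i , e) → opposite i , trans (cong (vert C) (opposite-involutive i)) e })

  -- Splicing two disjoint cycles whose last edges both have colour d,
  -- through the cross edges [C last, D 0] and [D last, C 0] of colour d:
  -- the cycle C 0 … C last, D 0 … D last, indexed by Fin (n₁ + n₂).
  module JoinAtLast (C D : AltCycle G) (disj : VertexDisjoint G C D) (d : Colour)
                    (C-last : col C last ≡ d) (D-last : col D last ≡ d)
                    (C→D : Edge (vert C last) (vert D zero) d)
                    (D→C : Edge (vert D last) (vert C zero) d) where
    n₁ n₂ K : ℕ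
    n₁ = suc (k C)
    n₂ = suc (k D)
    K = k C + n₂

    part : Fin (suc K) → Fin n₁ ⊎ Fin n₂
    part = splitAt n₁

    data Step : Fin n₁ ⊎ Fin n₂ → Fin n₁ ⊎ Fin n₂ → Set where
      inside-C : ∀ a → toℕ a < k C → Step (inj₁ a) (inj₁ (next a))
      C-to-D : Step (inj₁ last) (inj₂ zero)
      inside-D : ∀ b → toℕ b < k D → Step (inj₂ b) (inj₂ (next b))
      D-to-C : Step (inj₂ last) (inj₁ zero)

    kC<K : k C < K
    kC<K = ℕ.m<m+n (k C) (s≤s z≤n)

    step-C : ∀ (a : Fin n₁) → toℕ a < k C ⊎ toℕ a ≡ k C → Step (inj₁ a) (part (next {K} (a ↑ˡ n₂)))
    step-C a (inj₁ lt) = subst (Step (inj₁ a)) (sym (trans (cong part next-eq) (splitAt-↑ˡ n₁ (next a) n₂))) (inside-C a lt)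
      where
      next-eq : next {K} (a ↑ˡ n₂) ≡ next a ↑ˡ n₂
      next-eq = toℕ-injective (trans (next-below (a ↑ˡ n₂) (subst (_< K) (sym (toℕ-↑ˡ a n₂)) (ℕ.<-trans lt kC<K)))
                  (trans (cong suc (toℕ-↑ˡ a n₂)) (trans (sym (next-below a lt)) (sym (toℕ-↑ˡ (next a) n₂)))))
    step-C a (inj₂ eq) rewrite is-last a eq =
      subst (Step (inj₁ last)) (sym (trans (cong part next-eq) (splitAt-↑ʳ n₁ n₂ zero))) C-to-D
      where
      at-kC : toℕ (last {k C} ↑ˡ n₂) ≡ k C
      at-kC = trans (toℕ-↑ˡ last n₂) (toℕ-fromℕ (k C))
      next-eq : next {K} (last ↑ˡ n₂) ≡ n₁ ↑ʳ zero
      next-eq = toℕ-injective (trans (next-below (last ↑ˡ n₂) (subst (_< K) (sym at-kC) kC<K))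
                  (trans (cong suc at-kC) (trans (sym (ℕ.+-identityʳ n₁)) (sym (toℕ-↑ʳ n₁ (zero {n = k D}))))))

    step-D : ∀ (b : Fin n₂) → toℕ b < k D ⊎ toℕ b ≡ k D → Step (inj₂ b) (part (next {K} (n₁ ↑ʳ b)))
    step-D b (inj₁ lt) = subst (Step (inj₂ b)) (sym (trans (cong part next-eq) (splitAt-↑ʳ n₁ n₂ (next b)))) (inside-D b lt)
      where
      below : toℕ (n₁ ↑ʳ b) < K
      below = subst (_< K) (sym (toℕ-↑ʳ n₁ b))
                (subst (suc (k C + toℕ b) <_) (sym (ℕ.+-suc (k C) (k D))) (s≤s (ℕ.+-monoʳ-< (k C) lt)))
      next-eq : next {K} (n₁ ↑ʳ b) ≡ n₁ ↑ʳ next b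
      next-eq = toℕ-injective (trans (next-below (n₁ ↑ʳ b) below) (trans (cong suc (toℕ-↑ʳ n₁ b))
                  (trans (sym (ℕ.+-suc n₁ (toℕ b))) (trans (cong (n₁ +_) (sym (next-below b lt))) (sym (toℕ-↑ʳ n₁ (next b)))))))
    step-D b (inj₂ eq) rewrite is-last b eq = subst (Step (inj₂ last)) (sym (cong part next-eq)) D-to-C
      where
      next-eq : next {K} (n₁ ↑ʳ last {k D}) ≡ zero
      next-eq = next-at-last (n₁ ↑ʳ last {k D})
                  (trans (toℕ-↑ʳ n₁ (last {k D})) (trans (cong (n₁ +_) (toℕ-fromℕ (k D))) (sym (ℕ.+-suc (k C) (k D)))))

    step : ∀ i → Step (part i) (part (next i))
    step i = subst (λ z → Step (part z) (part (next {K} z))) (join-splitAt n₁ n₂ i)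
               (subst (λ u → Step u (part (next {K} (join n₁ n₂ (part i))))) (sym (splitAt-join n₁ n₂ (part i)))
                 (step-at (part i)))
      where
      step-at : ∀ u → Step u (part (next {K} (join n₁ n₂ u)))
      step-at (inj₁ a) = step-C a (below-or-last a)
      step-at (inj₂ b) = step-D b (below-or-last b)

    V : Fin n₁ ⊎ Fin n₂ → Vertex
    V = [ vert C , vert D ]

    Col : Fin n₁ ⊎ Fin n₂ → Colour
    Col = [ col C , col D ]

    step-edge : ∀ {u w} → Step u w → Edge (V u) (V w) (Col u)
    step-edge (inside-C a _) = edge C a
    step-edge C-to-D = subst (Edge (vert C last) (vert D zero)) (sym C-last) C→D
    step-edge (inside-D b _) = edge D b
    step-edge D-to-C = subst (Edge (vert D last) (vert C zero)) (sym D-last) D→C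

    -- Consecutive edges alternate: at a joint the d-edge is followed by the
    -- first edge of the other cycle, which differs from its last (d-)edge.
    step-alt : ∀ {u w} → Step u w → Col u ≢ Col w
    step-alt (inside-C a _) = alt C a
    step-alt C-to-D eq = alt D last (trans D-last (trans (sym C-last) (trans eq (cong (col D) (sym next-last)))))
    step-alt (inside-D b _) = alt D b
    step-alt D-to-C eq = alt C last (trans C-last (trans (sym D-last) (trans eq (cong (col C) (sym next-last)))))

    V-injective : ∀ {u w} → V u ≡ V w → u ≡ w
    V-injective {inj₁ a} {inj₁ a′} eq = cong inj₁ (inj C eq)
    V-injective {inj₁ a} {inj₂ b} eq = ⊥-elim (disj (vert C a) (a , refl) (b , sym eq))
    V-injective {inj₂ b} {inj₁ a} eq = ⊥-elim (disj (vert C a) (a , refl) (b , eq))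
    V-injective {inj₂ b} {inj₂ b′} eq = cong inj₂ (inj D eq)

    joined : AltCycle G
    joined = record
      { k = K ; k≥1 = ℕ.≤-trans (k≥1 C) (ℕ.m≤m+n (k C) n₂)
      ; vert = V ∘ part
      ; inj = λ {i} {j} eq → trans (sym (join-splitAt n₁ n₂ i))
                (trans (cong (join n₁ n₂) (V-injective {part i} {part j} eq)) (join-splitAt n₁ n₂ j))
      ; col = Col ∘ part
      ; edge = λ i → step-edge (step i)
      ; alt = λ i → step-alt (step i) }

    joined-union : Union C D
    joined-union = joined , λ v → mk⇔ (λ { (i , e) → from-part v (part i) e })
      (λ { (inj₁ (a , e)) → a ↑ˡ n₂ , trans (cong V (splitAt-↑ˡ n₁ a n₂)) e
         ; (inj₂ (b , e)) → n₁ ↑ʳ b , trans (cong V (splitAt-↑ʳ n₁ n₂ b)) e })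
      where
      from-part : ∀ v u → V u ≡ v → _∈V_ G v C ⊎ _∈V_ G v D
      from-part v (inj₁ a) e = inj₁ (a , e)
      from-part v (inj₂ b) e = inj₂ (b , e)

  -- Crossing splice: d-edges [C a, C (a+1)], [D b, D (b+1)] and the cross
  -- d-edges [C a, D (b+1)], [D b, C (a+1)] give the alternating cycle
  -- C (a+1) … C a, D (b+1) … D b.
  splice-crossing : ∀ C D → VertexDisjoint G C D → ∀ a b d → col C a ≡ d → col D b ≡ d →
    Edge (vert C a) (vert D (next b)) d → Edge (vert D b) (vert C (next a)) d → Union C D
  splice-crossing C D disj a b d Ca Db C→D D→C =
    union-≈V {C} {rotateC ra C} {D} {rotateC rb D} (rotateC-≈V ra C) (rotateC-≈V rb D) (JoinAtLast.joined-union (rotateC ra C) (rotateC rb D)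
      (disjoint-≈V {C} {rotateC ra C} {D} {rotateC rb D} (rotateC-≈V ra C) (rotateC-≈V rb D) disj) d
      (trans (cong (col C) (rotate-last a)) Ca) (trans (cong (col D) (rotate-last b)) Db)
      (subst₂ (λ x y → Edge (vert C x) (vert D y) d) (sym (rotate-last a)) (sym (rotate-first b)) C→D)
      (subst₂ (λ x y → Edge (vert D x) (vert C y) d) (sym (rotate-last b)) (sym (rotate-first a)) D→C))
    where
    ra rb : ℕ
    ra = suc (toℕ a)
    rb = suc (toℕ b)

  -- Parallel splice: the cross d-edges [C a, D b] and [C (a+1), D (b+1)]
  -- give a crossing splice of C with D reversed.
  splice-parallel : ∀ C D → VertexDisjoint G C D → ∀ a b d → col C a ≡ d → col D b ≡ d →
    Edge (vert C a) (vert D b) d → Edge (vert C (next a)) (vert D (next b)) d → Union C D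
  splice-parallel C D disj a b d Ca Db e₁ e₂ =
    union-≈V {C} {C} {D} {reverseC D} (λ _ → ⇔.refl) (reverseC-≈V D)
      (splice-crossing C (reverseC D) (disjoint-≈V {C} {C} {D} {reverseC D} (λ _ → ⇔.refl) (reverseC-≈V D) disj) a b′ d Ca Db′ e₁′ e₂′)
    where
    b′ : Fin (suc (k D))
    b′ = opposite (next b)
    Db′ : col (reverseC D) b′ ≡ d
    Db′ = trans (cong (col D ∘ prev) (opposite-involutive (next b))) (trans (cong (col D) (prev-next b)) Db)
    next-b′ : opposite (next b′) ≡ b
    next-b′ = trans (opposite-next b′) (trans (cong prev (opposite-involutive (next b))) (prev-next b))
    e₁′ : Edge (vert C a) (vert (reverseC D) (next b′)) d
    e₁′ = subst (λ z → Edge (vert C a) (vert D z) d) (sym next-b′) e₁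
    e₂′ : Edge (vert (reverseC D) b′) (vert C (next a)) d
    e₂′ = subst (λ z → Edge (vert D z) (vert C (next a)) d) (sym (opposite-involutive (next b))) (edge-sym e₂)

_≟ᶜ_ : (a b : Colour) → Dec (a ≡ b)
blue ≟ᶜ blue = yes refl
blue ≟ᶜ red = no (λ ())
red ≟ᶜ blue = no (λ ())
red ≟ᶜ red = yes refl

other-unique : ∀ {a b c : Colour} → a ≢ b → a ≢ c → b ≡ c
other-unique {blue} {blue} a≢b _ = ⊥-elim (a≢b refl)
other-unique {blue} {red} {blue} _ a≢c = ⊥-elim (a≢c refl)
other-unique {blue} {red} {red} _ _ = refl
other-unique {red} {blue} {blue} _ _ = refl
other-unique {red} {blue} {red} _ a≢c = ⊥-elim (a≢c refl)
other-unique {red} {red} a≢b _ = ⊥-elim (a≢b refl)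

-- Partners along an alternating cycle

module Partners (G : ColouredMultigraph) where
  open ColouredMultigraph G renaming (sym to edge-sym)
  open AltCycle
  open Surgery G

  -- Every position p of an alternating cycle lies on exactly one cycle edge
  -- of each colour d; partner C p d is the other end of that edge.
  partner : (C : AltCycle G) → Fin (suc (k C)) → Colour → Fin (suc (k C))
  partner C p d with col C p ≟ᶜ d
  ... | yes _ = next p
  ... | no _ = prev p

  Link : (C : AltCycle G) → Colour → Fin (suc (k C)) → Fin (suc (k C)) → Set
  Link C d p p′ = ∃ λ a → col C a ≡ d × ((a ≡ p × next a ≡ p′) ⊎ (a ≡ p′ × next a ≡ p))

  colour-before : (C : AltCycle G) (p : Fin (suc (k C))) → col C (prev p) ≢ col C p
  colour-before C p eq = alt C (prev p) (trans eq (cong (col C) (sym (next-prev p))))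

  partner-forward : (C : AltCycle G) → ∀ p d → col C p ≡ d → partner C p d ≡ next p
  partner-forward C p d Cp with col C p ≟ᶜ d
  ... | yes _ = refl
  ... | no Cp≢d = ⊥-elim (Cp≢d Cp)

  partner-link : (C : AltCycle G) → ∀ p d → Link C d p (partner C p d)
  partner-link C p d with col C p ≟ᶜ d
  ... | yes Cp = p , Cp , inj₁ (refl , refl)
  ... | no Cp≢d = prev p , other-unique (λ eq → colour-before C p (sym eq)) Cp≢d , inj₂ (refl , next-prev p)

  -- Partnership is symmetric: the d-edge at p is the d-edge at its partner.
  partner-involutive : (C : AltCycle G) → ∀ p d → partner C (partner C p d) d ≡ p
  partner-involutive C p d with col C p ≟ᶜ d
  ... | yes Cp with col C (next p) ≟ᶜ d
  ...   | yes Cnp = ⊥-elim (alt C p (trans Cp (sym Cnp)))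
  ...   | no _ = prev-next p
  partner-involutive C p d | no Cp≢d with col C (prev p) ≟ᶜ d
  ...   | yes _ = next-prev p
  ...   | no Cpp≢d = ⊥-elim (colour-before C p (other-unique (λ e → Cpp≢d (sym e)) (λ e → Cp≢d (sym e))))

  link-edge : (C : AltCycle G) → ∀ {d p p′} → Link C d p p′ → Edge (vert C p) (vert C p′) d
  link-edge C (a , Ca , inj₁ (refl , refl)) = subst (Edge (vert C a) (vert C (next a))) Ca (edge C a)
  link-edge C (a , Ca , inj₂ (refl , refl)) = edge-sym (subst (Edge (vert C a) (vert C (next a))) Ca (edge C a))

  square⇒union : ∀ C D → VertexDisjoint G C D → ∀ {d p p′ q q′} → Link C d p p′ → Link D d q q′ →
    Edge (vert C p) (vert D q) d → Edge (vert C p′) (vert D q′) d → Union C D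
  square⇒union C D disj (a , Ca , inj₁ (refl , refl)) (b , Db , inj₁ (refl , refl)) e e′ =
    splice-parallel C D disj a b _ Ca Db e e′
  square⇒union C D disj (a , Ca , inj₁ (refl , refl)) (b , Db , inj₂ (refl , refl)) e e′ =
    splice-crossing C D disj a b _ Ca Db e (edge-sym e′)
  square⇒union C D disj (a , Ca , inj₂ (refl , refl)) (b , Db , inj₁ (refl , refl)) e e′ =
    splice-crossing C D disj a b _ Ca Db e′ (edge-sym e)
  square⇒union C D disj (a , Ca , inj₂ (refl , refl)) (b , Db , inj₂ (refl , refl)) e e′ =
    splice-parallel C D disj a b _ Ca Db e′ e

-- Finite search, finite sums and Boolean indicators

search : ∀ {n} {P Q : Fin n → Set} → (∀ i → P i ⊎ Q i) → (∀ i → P i) ⊎ ∃ Q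
search {zero} f = inj₁ (λ ())
search {suc n} {P} {Q} f with f zero | search {n} {P ∘ suc} {Q ∘ suc} (f ∘ suc)
... | inj₂ q | _ = inj₂ (zero , q)
... | inj₁ _ | inj₂ (i , q) = inj₂ (suc i , q)
... | inj₁ p | inj₁ ps = inj₁ (λ { zero → p ; (suc i) → ps i })

search-colour : ∀ {P Q : Colour → Set} → (∀ c → P c ⊎ Q c) → (∀ c → P c) ⊎ ∃ Q
search-colour f with f blue | f red
... | inj₂ q | _ = inj₂ (blue , q)
... | inj₁ _ | inj₂ q = inj₂ (red , q)
... | inj₁ p | inj₁ p′ = inj₁ (λ { blue → p ; red → p′ })

sum-mono : ∀ {n} {f g : Fin n → ℕ} → (∀ i → f i ≤ g i) → sum f ≤ sum g
sum-mono {zero} _ = z≤n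
sum-mono {suc n} f≤g = ℕ.+-mono-≤ (f≤g zero) (sum-mono (f≤g ∘ suc))

sum-strict : ∀ {n} {f g : Fin n → ℕ} → (∀ i → f i ≤ g i) → ∀ j → f j < g j → sum f < sum g
sum-strict f≤g zero lt = ℕ.+-mono-<-≤ lt (sum-mono (f≤g ∘ suc))
sum-strict f≤g (suc j) lt = ℕ.+-mono-≤-< (f≤g zero) (sum-strict (f≤g ∘ suc) j lt)

sum-term : ∀ {n} (f : Fin n → ℕ) (i : Fin n) → f i ≤ sum f
sum-term f zero = ℕ.m≤m+n (f zero) _
sum-term f (suc i) = ℕ.≤-trans (sum-term (f ∘ suc) i) (ℕ.m≤n+m _ (f zero))

sum-involution : ∀ {n} (π : Fin n → Fin n) → (∀ i → π (π i) ≡ i) → (f : Fin n → ℕ) → sum (f ∘ π) ≡ sum f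
sum-involution π π-inv f = sym (∑-permute f (permutation π π π-inv π-inv))

total : ∀ {n₁ n₂} → (Fin n₁ → Fin n₂ → ℕ) → ℕ
total F = sum (λ p → sum (F p))

total-mono : ∀ {n₁ n₂} {F H : Fin n₁ → Fin n₂ → ℕ} → (∀ p q → F p q ≤ H p q) → total F ≤ total H
total-mono F≤H = sum-mono (λ p → sum-mono (F≤H p))

total-strict : ∀ {n₁ n₂} {F H : Fin n₁ → Fin n₂ → ℕ} → (∀ p q → F p q ≤ H p q) →
  ∀ p q → F p q < H p q → total F < total H
total-strict F≤H p q lt = sum-strict (λ p′ → sum-mono (F≤H p′)) p (sum-strict (F≤H p) q lt)

total-+ : ∀ {n₁ n₂} (F H : Fin n₁ → Fin n₂ → ℕ) → total (λ p q → F p q + H p q) ≡ total F + total H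
total-+ F H = trans (sum-cong-≗ (λ p → ∑-distrib-+ (F p) (H p))) (∑-distrib-+ (λ p → sum (F p)) (λ p → sum (H p)))

total-term : ∀ {n₁ n₂} (F : Fin n₁ → Fin n₂ → ℕ) p q → F p q ≤ total F
total-term F p q = ℕ.≤-trans (sum-term (F p) q) (sum-term (λ p → sum (F p)) p)

total-involution : ∀ {n₁ n₂} (π : Fin n₁ → Fin n₁) (σ : Fin n₂ → Fin n₂) →
  (∀ p → π (π p) ≡ p) → (∀ q → σ (σ q) ≡ q) → (F : Fin n₁ → Fin n₂ → ℕ) →
  total (λ p q → F (π p) (σ q)) ≡ total F
total-involution π σ π-inv σ-inv F =
  trans (sum-cong-≗ (λ p → sum-involution σ σ-inv (F (π p)))) (sum-involution π π-inv (λ p → sum (F p)))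

not-both-or-both : ∀ x y → (x ≡ true → y ≡ true → ⊥) ⊎ (x ≡ true × y ≡ true)
not-both-or-both true true = inj₂ (refl , refl)
not-both-or-both true false = inj₁ (λ _ ())
not-both-or-both false _ = inj₁ (λ ())

⟦_⟧ : Bool → ℕ
⟦ true ⟧ = 1
⟦ false ⟧ = 0

⟦⟧-mono : ∀ {x y} → (x ≡ true → y ≡ true) → ⟦ x ⟧ ≤ ⟦ y ⟧
⟦⟧-mono {false} _ = z≤n
⟦⟧-mono {true} x⇒y rewrite x⇒y refl = ℕ.≤-refl

⟦⟧-∨ : ∀ x y → ⟦ x ∨ y ⟧ ≤ ⟦ x ⟧ + ⟦ y ⟧
⟦⟧-∨ true _ = s≤s z≤n
⟦⟧-∨ false _ = ℕ.≤-refl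

⟦⟧-cover : ∀ {a b c y : Bool} → (a ≡ true → y ≡ true) → (b ≡ true → y ≡ true) → (c ≡ true → y ≡ true) →
  ⟦ a ∨ b ∨ c ⟧ ≤ ⟦ y ⟧
⟦⟧-cover {true} a⇒y _ _ = ⟦⟧-mono a⇒y
⟦⟧-cover {false} {true} _ b⇒y _ = ⟦⟧-mono b⇒y
⟦⟧-cover {false} {false} _ _ c⇒y = ⟦⟧-mono c⇒y

module Saturation {A : Set} (_⊑_ : A → A → Set) (⊑-refl : ∀ {x} → x ⊑ x)
  (⊑-trans : ∀ {x y z} → x ⊑ y → y ⊑ z → x ⊑ z) (size : A → ℕ) (Admissible Done : A → Set)
  (progress : ∀ x → Admissible x → Done x ⊎ ∃ λ y → Admissible y × x ⊑ y × size y < size x) where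

  saturate-acc : ∀ x → Acc (_<_ on size) x → Admissible x → ∃ λ y → Admissible y × Done y × x ⊑ y
  saturate-acc x (acc smaller) ax with progress x ax
  ... | inj₁ done = x , ax , done , ⊑-refl
  ... | inj₂ (y , ay , x⊑y , y<x) with saturate-acc y (smaller y<x) ay
  ...   | z , az , done , y⊑z = z , az , done , ⊑-trans x⊑y y⊑z

  saturate : ∀ x → Admissible x → ∃ λ y → Admissible y × Done y × x ⊑ y
  saturate x = saturate-acc x (On.wellFounded size <-wellFounded x)

-- Boolean tables of cross pairs: which (position, position, colour)
-- triples are known to carry a cross edge.

module Tables (n₁ n₂ : ℕ) where

  Table : Set
  Table = Fin n₁ → Fin n₂ → Colour → Bool

  _⊆_ : Table → Table → Set
  K ⊆ K′ = ∀ p q c → K p q c ≡ true → K′ p q c ≡ true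

  search-entries : ∀ {P Q : Fin n₁ → Fin n₂ → Colour → Set} → (∀ p q c → P p q c ⊎ Q p q c) →
    (∀ p q c → P p q c) ⊎ ∃ λ p → ∃ λ q → ∃ λ c → Q p q c
  search-entries f with search (λ p → search (λ q → search-colour (f p q)))
  ... | inj₁ all = inj₁ all
  ... | inj₂ (p , q , c , viol) = inj₂ (p , q , c , viol)

  insert : Table → Fin n₁ → Fin n₂ → Colour → Table
  insert K p₀ q₀ c₀ p q c = K p q c ∨ (does (p ≟ p₀) ∧ does (q ≟ q₀) ∧ does (c ≟ᶜ c₀))

  insert-⊆ : ∀ K p₀ q₀ c₀ → K ⊆ insert K p₀ q₀ c₀
  insert-⊆ K p₀ q₀ c₀ p q c Kpqc rewrite Kpqc = refl

  insert-hit : ∀ K p₀ q₀ c₀ → insert K p₀ q₀ c₀ p₀ q₀ c₀ ≡ true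
  insert-hit K p₀ q₀ c₀
    rewrite dec-true (p₀ ≟ p₀) refl | dec-true (q₀ ≟ q₀) refl | dec-true (c₀ ≟ᶜ c₀) refl = ∨-zeroʳ (K p₀ q₀ c₀)

  insert-cases : ∀ K p₀ q₀ c₀ p q c → insert K p₀ q₀ c₀ p q c ≡ true →
    K p q c ≡ true ⊎ (p ≡ p₀ × q ≡ q₀ × c ≡ c₀)
  insert-cases K p₀ q₀ c₀ p q c present with p ≟ p₀ | q ≟ q₀ | c ≟ᶜ c₀
  ... | yes p≡ | yes q≡ | yes c≡ = inj₂ (p≡ , q≡ , c≡)
  ... | yes _ | yes _ | no _ = inj₁ (trans (sym (∨-identityʳ (K p q c))) present)
  ... | yes _ | no _ | _ = inj₁ (trans (sym (∨-identityʳ (K p q c))) present)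
  ... | no _ | _ | _ = inj₁ (trans (sym (∨-identityʳ (K p q c))) present)

  gaps : Table → ℕ
  gaps K = total (λ p q → ⟦ not (K p q blue) ⟧ + ⟦ not (K p q red) ⟧)

  gaps-< : ∀ {K K′} → K ⊆ K′ → ∀ p q c → K p q c ≡ false → K′ p q c ≡ true → gaps K′ < gaps K
  gaps-< {K} {K′} K⊆K′ p q c absent present = total-strict entry-≤ p q (entry-< c absent present)
    where
    not-≤ : ∀ {x y} → (x ≡ true → y ≡ true) → ⟦ not y ⟧ ≤ ⟦ not x ⟧
    not-≤ {true} x⇒y rewrite x⇒y refl = ℕ.≤-refl
    not-≤ {false} {true} _ = z≤n
    not-≤ {false} {false} _ = ℕ.≤-refl
    entry-≤ : ∀ p q → ⟦ not (K′ p q blue) ⟧ + ⟦ not (K′ p q red) ⟧ ≤ ⟦ not (K p q blue) ⟧ + ⟦ not (K p q red) ⟧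
    entry-≤ p q = ℕ.+-mono-≤ (not-≤ (K⊆K′ p q blue)) (not-≤ (K⊆K′ p q red))
    entry-< : ∀ c → K p q c ≡ false → K′ p q c ≡ true →
      ⟦ not (K′ p q blue) ⟧ + ⟦ not (K′ p q red) ⟧ < ⟦ not (K p q blue) ⟧ + ⟦ not (K p q red) ⟧
    entry-< blue absent present rewrite absent | present = s≤s (not-≤ (K⊆K′ p q red))
    entry-< red absent present rewrite absent | present = ℕ.+-mono-≤-< (not-≤ (K⊆K′ p q blue)) (s≤s z≤n)

-- The block-counting lemma

-- One 2×2 block with entries a (at the base cell), b (its row-mate),
-- c (its column-mate) and o (the opposite corner), free of diagonal pairs.
-- Every entry occupies its own cell and, by closure, its row- and
-- column-mate, so the four cells are covered at least twice the number of
-- entries; a lone entry a covers three cells, one more than twice its weight.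
block-bound : ∀ a b c o → (a ≡ true → o ≡ true → ⊥) → (b ≡ true → c ≡ true → ⊥) →
  (⟦ a ⟧ + ⟦ b ⟧ + ⟦ c ⟧ + ⟦ o ⟧) + (⟦ a ⟧ + ⟦ b ⟧ + ⟦ c ⟧ + ⟦ o ⟧) + ⟦ a ∧ not b ∧ not c ⟧
    ≤ ⟦ a ∨ b ∨ c ⟧ + ⟦ a ∨ b ∨ o ⟧ + ⟦ a ∨ c ∨ o ⟧ + ⟦ b ∨ c ∨ o ⟧
block-bound true _ _ true a-o _ = ⊥-elim (a-o refl refl)
block-bound _ true true _ _ b-c = ⊥-elim (b-c refl refl)
block-bound true true false false _ _ = ℕ.≤ᵇ⇒≤ _ _ _
block-bound true false true false _ _ = ℕ.≤ᵇ⇒≤ _ _ _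
block-bound true false false false _ _ = ℕ.≤ᵇ⇒≤ _ _ _
block-bound false true false true _ _ = ℕ.≤ᵇ⇒≤ _ _ _
block-bound false true false false _ _ = ℕ.≤ᵇ⇒≤ _ _ _
block-bound false false true true _ _ = ℕ.≤ᵇ⇒≤ _ _ _
block-bound false false true false _ _ = ℕ.≤ᵇ⇒≤ _ _ _
block-bound false false false true _ _ = ℕ.≤ᵇ⇒≤ _ _ _
block-bound false false false false _ _ = ℕ.≤ᵇ⇒≤ _ _ _

-- Summing the block bound over both colours: with s_d entries of colour d,
-- l_d lone ones and e occupied cells, 8 s_d + l_d ≤ 4 e while e ≤ s_blue + s_red,
-- so there are no lone entries at all.
no-lonely-arithmetic : ∀ sb sr lb lr e → 4 * sb + 4 * sb + lb ≤ 4 * e → 4 * sr + 4 * sr + lr ≤ 4 * e →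
  e ≤ sb + sr → lb + lr ≤ 0
no-lonely-arithmetic sb sr lb lr e blue-bound red-bound e-bound = ℕ.+-cancelˡ-≤ (8 * (sb + sr)) _ _ (begin
  8 * (sb + sr) + (lb + lr)                        ≡⟨ solve (sb ∷ sr ∷ lb ∷ lr ∷ []) ⟩
  (4 * sb + 4 * sb + lb) + (4 * sr + 4 * sr + lr)  ≤⟨ ℕ.+-mono-≤ blue-bound red-bound ⟩
  4 * e + 4 * e                                    ≡⟨ solve (e ∷ []) ⟩
  8 * e                                            ≤⟨ ℕ.*-monoʳ-≤ 8 e-bound ⟩
  8 * (sb + sr)                                    ≡⟨ sym (ℕ.+-identityʳ _) ⟩
  8 * (sb + sr) + 0                                ∎)
  where open ℕ.≤-Reasoning

four-times : ∀ x → x + x + x + x ≡ 4 * x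
four-times = solve-∀

-- h d and v d pair up the positions along the two sides of the torus
-- (in the application: the d-coloured edges of C₁ and C₂), so that the
-- d-block of the cell (p,q) is {p, h d p} × {q, v d q}.
module BlockCounting {n₁ n₂ : ℕ} (h : Colour → Fin n₁ → Fin n₁) (v : Colour → Fin n₂ → Fin n₂)
  (h-involutive : ∀ d p → h d (h d p) ≡ p) (v-involutive : ∀ d q → v d (v d q) ≡ q)
  (K : Tables.Table n₁ n₂) where

  occupied : Fin n₁ → Fin n₂ → Bool
  occupied p q = K p q blue ∨ K p q red

  SquareFree : Set
  SquareFree = ∀ p q d → K p q d ≡ true → K (h d p) (v d q) d ≡ true → ⊥

  Closed : Set
  Closed = ∀ p q d → K p q d ≡ true → occupied (h d p) q ≡ true × occupied p (v d q) ≡ true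

  entry-occupied : ∀ p q d → K p q d ≡ true → occupied p q ≡ true
  entry-occupied p q blue present rewrite present = refl
  entry-occupied p q red present rewrite present = ∨-zeroʳ (K p q blue)

  occupied-entry : ∀ p q → occupied p q ≡ true → ∃ λ c → K p q c ≡ true
  occupied-entry p q present with K p q blue in b
  ... | true = blue , b
  ... | false = red , present

  block : Colour → (Fin n₁ → Fin n₂ → ℕ) → Fin n₁ → Fin n₂ → ℕ
  block d F p q = F p q + F (h d p) q + F p (v d q) + F (h d p) (v d q)

  -- Every cell is the base of one d-block in each of four positions.
  total-block : ∀ d F → total (block d F) ≡ 4 * total F
  total-block d F = begin
    total (block d F)                                          ≡⟨ split ⟩
    total F + total (F ∘ h d) + total (λ p → F p ∘ v d) + total (λ p → F (h d p) ∘ v d)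
      ≡⟨ cong₂ _+_ (cong₂ _+_ (cong (total F +_) (reindex (h d) id (h-involutive d) (λ _ → refl)))
                              (reindex id (v d) (λ _ → refl) (v-involutive d)))
                   (reindex (h d) (v d) (h-involutive d) (v-involutive d)) ⟩
    total F + total F + total F + total F                      ≡⟨ four-times (total F) ⟩
    4 * total F                                                ∎
    where
    open ≡-Reasoning
    reindex : ∀ π σ → (∀ p → π (π p) ≡ p) → (∀ q → σ (σ q) ≡ q) → total (λ p q → F (π p) (σ q)) ≡ total F
    reindex π σ π-inv σ-inv = total-involution π σ π-inv σ-inv F
    split : total (block d F) ≡ total F + total (F ∘ h d) + total (λ p → F p ∘ v d) + total (λ p → F (h d p) ∘ v d)
    split = trans (total-+ (λ p q → F p q + F (h d p) q + F p (v d q)) (λ p q → F (h d p) (v d q)))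
             (cong (_+ total (λ p q → F (h d p) (v d q)))
               (trans (total-+ (λ p q → F p q + F (h d p) q) (λ p q → F p (v d q)))
                 (cong (_+ total (λ p q → F p (v d q))) (total-+ F (λ p q → F (h d p) q)))))

  module _ (square-free : SquareFree) (closed : Closed) where

    square-free′ : ∀ p q d → K (h d p) q d ≡ true → K p (v d q) d ≡ true → ⊥
    square-free′ p q d b c = square-free (h d p) q d b (subst (λ z → K z (v d q) d ≡ true) (sym (h-involutive d p)) c)

    from-row-mate : ∀ p q d → K (h d p) q d ≡ true → occupied p q ≡ true
    from-row-mate p q d present = subst (λ z → occupied z q ≡ true) (h-involutive d p) (proj₁ (closed (h d p) q d present))

    from-column-mate : ∀ p q d → K p (v d q) d ≡ true → occupied p q ≡ true
    from-column-mate p q d present = subst (λ z → occupied p z ≡ true) (v-involutive d q) (proj₂ (closed p (v d q) d present))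

    entries : Colour → Fin n₁ → Fin n₂ → ℕ
    entries d p q = ⟦ K p q d ⟧

    cells : Fin n₁ → Fin n₂ → ℕ
    cells p q = ⟦ occupied p q ⟧

    lonely : Colour → Fin n₁ → Fin n₂ → ℕ
    lonely d p q = ⟦ K p q d ∧ not (K (h d p) q d) ∧ not (K p (v d q) d) ⟧

    local-bound : ∀ d p q → block d (entries d) p q + block d (entries d) p q + lonely d p q ≤ block d cells p q
    local-bound d p q = ℕ.≤-trans (block-bound _ _ _ _ (square-free p q d) (square-free′ p q d))
      (ℕ.+-mono-≤ (ℕ.+-mono-≤ (ℕ.+-mono-≤
        (⟦⟧-cover (entry-occupied p q d) (from-row-mate p q d) (from-column-mate p q d))
        (⟦⟧-cover (proj₁ ∘ closed p q d) (entry-occupied p′ q d) (from-column-mate p′ q d)))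
        (⟦⟧-cover (proj₂ ∘ closed p q d) (entry-occupied p q′ d) (from-row-mate p q′ d)))
        (⟦⟧-cover (proj₂ ∘ closed p′ q d) (proj₁ ∘ closed p q′ d) (entry-occupied p′ q′ d)))
      where
      p′ = h d p
      q′ = v d q

    colour-bound : ∀ d → 4 * total (entries d) + 4 * total (entries d) + total (lonely d) ≤ 4 * total cells
    colour-bound d = begin
      4 * total (entries d) + 4 * total (entries d) + total (lonely d)
        ≡⟨ cong (_+ total (lonely d)) (sym doubled) ⟩
      total (λ p q → block d (entries d) p q + block d (entries d) p q) + total (lonely d)
        ≡⟨ sym (total-+ (λ p q → block d (entries d) p q + block d (entries d) p q) (lonely d)) ⟩
      total (λ p q → block d (entries d) p q + block d (entries d) p q + lonely d p q)
        ≤⟨ total-mono (local-bound d) ⟩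
      total (block d cells)
        ≡⟨ total-block d cells ⟩
      4 * total cells ∎
      where
      open ℕ.≤-Reasoning
      doubled : total (λ p q → block d (entries d) p q + block d (entries d) p q) ≡ 4 * total (entries d) + 4 * total (entries d)
      doubled = trans (total-+ (block d (entries d)) (block d (entries d)))
                      (cong₂ _+_ (total-block d (entries d)) (total-block d (entries d)))

    cells-bound : total cells ≤ total (entries blue) + total (entries red)
    cells-bound = ℕ.≤-trans (total-mono (λ p q → ⟦⟧-∨ (K p q blue) (K p q red))) (ℕ.≤-reflexive (total-+ (entries blue) (entries red)))

    no-lonely : total (lonely blue) + total (lonely red) ≤ 0
    no-lonely = no-lonely-arithmetic (total (entries blue)) (total (entries red)) (total (lonely blue)) (total (lonely red)) (total cells)
                  (colour-bound blue) (colour-bound red) cells-bound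

    companion : ∀ p q d → K p q d ≡ true → K (h d p) q d ≡ true ⊎ K p (v d q) d ≡ true
    companion p q d present with K (h d p) q d in row | K p (v d q) d in column
    ... | true | _ = inj₁ refl
    ... | false | true = inj₂ refl
    ... | false | false = ⊥-elim (ℕ.1+n≰n (ℕ.≤-trans lonely-here (ℕ.≤-trans (total-term (lonely d) p q) (lonely-total d))))
      where
      lonely-here : 1 ≤ lonely d p q
      lonely-here rewrite present | row | column = ℕ.≤-refl
      lonely-total : ∀ d → total (lonely d) ≤ 0
      lonely-total blue = ℕ.m+n≤o⇒m≤o _ no-lonely
      lonely-total red = ℕ.m+n≤o⇒n≤o (total (lonely blue)) no-lonely

    opposite-occupied : ∀ p q d → K p q d ≡ true → occupied (h d p) (v d q) ≡ true
    opposite-occupied p q d present with companion p q d present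
    ... | inj₁ row = proj₂ (closed (h d p) q d row)
    ... | inj₂ column = proj₁ (closed p (v d q) d column)

-- Cross edges between two disjoint alternating cycles

module Crossing (G : ColouredMultigraph) (closure : TwoMClosed G) (C₁ C₂ : AltCycle G)
                (disjoint : VertexDisjoint G C₁ C₂) where
  open ColouredMultigraph G renaming (sym to edge-sym)
  open AltCycle
  open Surgery G
  open Partners G

  n₁ n₂ : ℕ
  n₁ = suc (k C₁)
  n₂ = suc (k C₂)

  open Tables n₁ n₂ public

  X : Fin n₁ → Vertex
  X = vert C₁

  Y : Fin n₂ → Vertex
  Y = vert C₂

  h : Colour → Fin n₁ → Fin n₁
  h d p = partner C₁ p d

  v : Colour → Fin n₂ → Fin n₂
  v d q = partner C₂ q d

  module Count (K : Table) = BlockCounting h v (λ d p → partner-involutive C₁ p d) (λ d q → partner-involutive C₂ q d) K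
  open Count public using (occupied; Closed; SquareFree)

  X≢Y : ∀ p q → X p ≢ Y q
  X≢Y p q eq = disjoint (X p) (p , refl) (q , sym eq)

  row-mate-edge : ∀ {p q d} → Edge (X p) (Y q) d → ∃ λ c → Edge (X (h d p)) (Y q) c
  row-mate-edge {p} {q} {d} e = closure (X≢Y (h d p) q) (edge-sym (link-edge C₁ (partner-link C₁ p d))) e

  column-mate-edge : ∀ {p q d} → Edge (X p) (Y q) d → ∃ λ c → Edge (X p) (Y (v d q)) c
  column-mate-edge {p} {q} {d} e = closure (X≢Y p (v d q)) e (link-edge C₂ (partner-link C₂ q d))

  Sound : Table → Set
  Sound K = ∀ p q d → K p q d ≡ true → Edge (X p) (Y q) d

  insert-sound : ∀ K p₀ q₀ c₀ → Sound K → Edge (X p₀) (Y q₀) c₀ → Sound (insert K p₀ q₀ c₀)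
  insert-sound K p₀ q₀ c₀ sound e p q c present with insert-cases K p₀ q₀ c₀ p q c present
  ... | inj₁ old = sound p q c old
  ... | inj₂ (refl , refl , refl) = e

  fill : ∀ K p q → Sound K → occupied K p q ≡ false → (∃ λ c → Edge (X p) (Y q) c) →
    ∃ λ K′ → Sound K′ × K ⊆ K′ × gaps K′ < gaps K
  fill K p q sound free (c , e) =
    insert K p q c , insert-sound K p q c sound e , insert-⊆ K p q c ,
    gaps-< (insert-⊆ K p q c) p q c (absent c free) (insert-hit K p q c)
    where
    absent : ∀ c → occupied K p q ≡ false → K p q c ≡ false
    absent blue free with K p q blue | K p q red
    absent blue refl | false | false = refl
    absent red free with K p q blue | K p q red
    absent red refl | false | false = refl

  Defect : Table → Fin n₁ → Fin n₂ → Colour → Set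
  Defect K p q d = K p q d ≡ true × (occupied K (h d p) q ≡ false ⊎ occupied K p (v d q) ≡ false)

  closed-or-defect : ∀ K p q d →
    (K p q d ≡ true → occupied K (h d p) q ≡ true × occupied K p (v d q) ≡ true) ⊎ Defect K p q d
  closed-or-defect K p q d with K p q d | occupied K (h d p) q | occupied K p (v d q)
  ... | false | _ | _ = inj₁ (λ ())
  ... | true | true | true = inj₁ (λ _ → refl , refl)
  ... | true | false | _ = inj₂ (refl , inj₁ refl)
  ... | true | true | false = inj₂ (refl , inj₂ refl)

  closure-step : ∀ K → Sound K → Closed K ⊎ ∃ λ K′ → Sound K′ × K ⊆ K′ × gaps K′ < gaps K
  closure-step K sound with search-entries (closed-or-defect K)
  ... | inj₁ closed = inj₁ closed
  ... | inj₂ (p , q , d , present , inj₁ free) = inj₂ (fill K (h d p) q sound free (row-mate-edge (sound p q d present)))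
  ... | inj₂ (p , q , d , present , inj₂ free) = inj₂ (fill K p (v d q) sound free (column-mate-edge (sound p q d present)))

  open Saturation _⊆_ (λ p q c present → present) (λ K⊆K′ K′⊆K″ p q c → K′⊆K″ p q c ∘ K⊆K′ p q c) gaps Sound Closed closure-step
    public using (saturate)

  square-free-or-union : ∀ K → Sound K → SquareFree K ⊎ Union C₁ C₂
  square-free-or-union K sound with search-entries (λ p q d → not-both-or-both (K p q d) (K (h d p) (v d q) d))
  ... | inj₁ square-free = inj₁ square-free
  ... | inj₂ (p , q , d , present , present′) =
    inj₂ (square⇒union C₁ C₂ disjoint (partner-link C₁ p d) (partner-link C₂ q d) (sound p q d present) (sound _ _ d present′))

  opposite-corner : ∀ K → Sound K → Closed K → SquareFree K → ∀ p q d → K p q d ≡ true →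
    ∃ λ c → c ≢ d × Edge (X (h d p)) (Y (v d q)) c
  opposite-corner K sound closed square-free p q d present
    with Count.occupied-entry K (h d p) (v d q) (Count.opposite-occupied K square-free closed p q d present)
  ... | c , present′ with c ≟ᶜ d
  ...   | yes refl = ⊥-elim (square-free p q d present present′)
  ...   | no c≢d = c , c≢d , sound _ _ c present′

mainTheorem3 : (G : ColouredMultigraph) → TwoMClosed G →
    (C₁ C₂ : AltCycle G) → VertexDisjoint G C₁ C₂ →
    (i : Fin (suc (AltCycle.k C₁))) → (j : Fin (suc (AltCycle.k C₂))) →
    AltCycle.col C₁ i ≡ AltCycle.col C₂ j →
    ColouredMultigraph.Edge G (AltCycle.vert C₁ i) (AltCycle.vert C₂ j) (AltCycle.col C₁ i) →
    ((∃ λ c → c ≢ AltCycle.col C₁ i × ColouredMultigraph.Edge G (AltCycle.vert C₁ (next i)) (AltCycle.vert C₂ (next j)) c)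
    × (∃ λ c → ColouredMultigraph.Edge G (AltCycle.vert C₁ i) (AltCycle.vert C₂ (next j)) c)
    × (∃ λ c → ColouredMultigraph.Edge G (AltCycle.vert C₂ j) (AltCycle.vert C₁ (next i)) c))
    ⊎ (∃ λ (C : AltCycle G) → ∀ v → (_∈V_ G v C) ⇔ (_∈V_ G v C₁ ⊎ _∈V_ G v C₂))
mainTheorem3 G closure C₁ C₂ disjoint i j same e₀ =
  map₁ (λ square-free → far-edge square-free , side-edges) (square-free-or-union K sound)
  where
  open ColouredMultigraph G using (Edge) renaming (sym to edge-sym)
  open Crossing G closure C₁ C₂ disjoint
  d : Colour
  d = AltCycle.col C₁ i
  hi : h d i ≡ next i
  hi = Partners.partner-forward G C₁ i d refl
  vj : v d j ≡ next j
  vj = Partners.partner-forward G C₂ j d (sym same)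
  K₀ : Table
  K₀ = insert (λ _ _ _ → false) i j d
  saturated : ∃ λ K → Sound K × Closed K × K₀ ⊆ K
  saturated = saturate K₀ (insert-sound (λ _ _ _ → false) i j d (λ _ _ _ ()) e₀)
  K : Table
  K = proj₁ saturated
  sound : Sound K
  sound = proj₁ (proj₂ saturated)
  closed : Closed K
  closed = proj₁ (proj₂ (proj₂ saturated))
  K₀⊆K : K₀ ⊆ K
  K₀⊆K = proj₂ (proj₂ (proj₂ saturated))
  far-edge : SquareFree K → ∃ λ c → c ≢ d × Edge (X (next i)) (Y (next j)) c
  far-edge square-free with opposite-corner K sound closed square-free i j d (K₀⊆K i j d (insert-hit (λ _ _ _ → false) i j d))
  ... | c , c≢d , e = c , c≢d , subst₂ (λ p q → Edge (X p) (Y q) c) hi vj e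
  side-edges : (∃ λ c → Edge (X i) (Y (next j)) c) × (∃ λ c → Edge (Y j) (X (next i)) c)
  side-edges with column-mate-edge e₀ | row-mate-edge e₀
  ... | c , e | c′ , e′ = (c , subst (λ q → Edge (X i) (Y q) c) vj e) , (c′ , edge-sym (subst (λ p → Edge (X p) (Y j) c′) hi e′))
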